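{- Let $G$ be a digraph, $S,T\subseteq V(G)$ disjoint, $k$ a nonnegative integer. Suppose $G$ has a gapless $S$--$T$ chain of order $k$ and let $(X,Y)$ be a minimum $S$--$T$ separation of $G$. Then $G$ has a gapless $S$--$T$ chain of order at most $k$ of the form $C_1+(X,Y)+C_2$, where $C_1$ is a gapless $S$--$(Y\setminus X)$ chain and $C_2$ is a gapless $(X\setminus Y)$--$T$ chain.
   Context: A separation of a digraph $G$ is a pair $(A,B)$ with $A\cup B=V(G)$ and no edge from $A\setminus B$ to $B\setminus A$; its order is $|A\cap B|$. For disjoint $S,T$, an $S$--$T$ separation is a separation $(A,B)$ with $S\cap B=\emptyset$ and $T\cap A=\emptyset$; a minimum one has smallest order. A separation chain is a sequence $((A_0,B_0),\dots,(A_r,B_r))$ of separations with $A_0\subseteq\dots\subseteq A_r$ and $B_r\subseteq\dots\subseteq B_0$; its order is the maximum order of its members; it is gapless if for every $0<i\le r$, $|A_i\setminus A_{i-1}|\le 1$ or $|B_{i-1}\setminus B_i|\le 1$; it is an $S$--$T$ chain if $B_0=V(G)\setminus S$ and $A_r=V(G)\setminus T$. For sequences of separations, $C_1+(X,Y)+C_2$ denotes the concatenation of $C_1$, the single separation $(X,Y)$, and $C_2$. -}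

module Defs where

open import Data.Nat using (ℕ; zero; suc; _≤_; _⊔_)
open import Data.Fin using (Fin)
open import Data.Fin.Subset using (Subset; _∈_; _∉_; _⊆_; _∩_; _∪_; _─_; ∁; ∣_∣; ⊥; ⊤)
open import Data.List using (List; []; _∷_; _++_; [_])
open import Data.Product using (_×_; _,_; Σ)
open import Data.Sum using (_⊎_)
open import Relation.Binary.PropositionalEquality using (_≡_)
open import Relation.Nullary using (¬_)

record Digraph (n : ℕ) : Set₁ where
  field
    Edge : Fin n → Fin n → Set

open Digraph public

Sep : ℕ → Set
Sep n = Subset n × Subset n

IsSeparation : ∀ {n} → Digraph n → Sep n → Set
IsSeparation {n} G (A , B) =
  (A ∪ B ≡ ⊤) ×
  (∀ (u v : Fin n) → Edge G u v → u ∈ A ─ B → v ∉ B ─ A)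

order : ∀ {n} → Sep n → ℕ
order (A , B) = ∣ A ∩ B ∣

IsSTSeparation : ∀ {n} → Digraph n → Subset n → Subset n → Sep n → Set
IsSTSeparation G S T (A , B) =
  IsSeparation G (A , B) × (S ∩ B ≡ ⊥) × (T ∩ A ≡ ⊥)

IsMinSTSeparation : ∀ {n} → Digraph n → Subset n → Subset n → Sep n → Set
IsMinSTSeparation {n} G S T X =
  IsSTSeparation G S T X ×
  (∀ (Z : Sep n) → IsSTSeparation G S T Z → order X ≤ order Z)

Nested : ∀ {n} → Sep n → Sep n → Set
Nested (A , B) (A' , B') = (A ⊆ A') × (B' ⊆ B)

NoGap : ∀ {n} → Sep n → Sep n → Set
NoGap (A , B) (A' , B') = (∣ A' ─ A ∣ ≤ 1) ⊎ (∣ B ─ B' ∣ ≤ 1)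

Consecutive : ∀ {n} → (Sep n → Sep n → Set) → List (Sep n) → Set
Consecutive R [] = Data.Unit.⊤
  where import Data.Unit
Consecutive R (x ∷ []) = Data.Unit.⊤
  where import Data.Unit
Consecutive R (x ∷ y ∷ xs) = R x y × Consecutive R (y ∷ xs)

AllSeps : ∀ {n} → Digraph n → List (Sep n) → Set
AllSeps G [] = Data.Unit.⊤
  where import Data.Unit
AllSeps G (x ∷ xs) = IsSeparation G x × AllSeps G xs

IsChain : ∀ {n} → Digraph n → List (Sep n) → Set
IsChain G [] = Data.Empty.⊥
  where import Data.Empty
IsChain G (x ∷ xs) = AllSeps G (x ∷ xs) × Consecutive Nested (x ∷ xs)

IsGapless : ∀ {n} → List (Sep n) → Set
IsGapless C = Consecutive NoGap C

chainOrder : ∀ {n} → List (Sep n) → ℕ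
chainOrder [] = 0
chainOrder (x ∷ xs) = order x ⊔ chainOrder xs

-- First B and last A of a nonempty list (junk for the empty list,
-- which is never a chain).
firstB : ∀ {n} → List (Sep n) → Subset n
firstB [] = ⊤
firstB ((A , B) ∷ _) = B

lastA : ∀ {n} → List (Sep n) → Subset n
lastA [] = ⊥
lastA ((A , B) ∷ []) = A
lastA (_ ∷ y ∷ xs) = lastA (y ∷ xs)

IsSTChain : ∀ {n} → Digraph n → Subset n → Subset n → List (Sep n) → Set
IsSTChain G S T C = IsChain G C × (firstB C ≡ ∁ S) × (lastA C ≡ ∁ T)

IsGaplessSTChain : ∀ {n} → Digraph n → Subset n → Subset n → List (Sep n) → Set
IsGaplessSTChain G S T C = IsSTChain G S T C × IsGapless C

Disjoint : ∀ {n} → Subset n → Subset n → Set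
Disjoint S T = S ∩ T ≡ ⊥

-- Uncross the given chain with t = (X , Y). For an S–T separation s = (A , B)
-- the corners s ⊓ˢ t = (A ∩ X , B ∪ Y) and s ⊔ˢ t = (A ∪ X , B ∩ Y) are again
-- S–T separations, and order is submodular:
--   order (s ⊓ˢ t) + order (s ⊔ˢ t) ≤ order s + order t,
-- so minimality of t makes neither corner larger than s. Both corner maps are
-- monotone and can only shrink the differences A′ ∖ A and B ∖ B′, so applying
-- them to every member of the chain gives gapless chains that end just below t
-- and start just above it; X ∪ Y = V, S ∩ Y = ∅ and T ∩ X = ∅ put their outer
-- ends at V ∖ S, V ∖ (Y ∖ X), V ∖ (X ∖ Y) and V ∖ T.
module Submission where

open import Defs
open import Data.Nat using (ℕ; suc; _≤_; _+_; z≤n)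
open import Data.Nat.Properties
  using (≤-trans; ≤-reflexive; +-mono-≤; +-monoˡ-≤; +-monoʳ-≤; +-cancelˡ-≤; +-cancelʳ-≤; +-comm; +-suc; n≤0⇒n≡0;
         ⊔-lub; m≤m⊔n; m≤n⊔m; module ≤-Reasoning)
open import Data.Fin using (Fin)
open import Data.Fin.Subset
  using (Subset; _∈_; _∉_; _⊆_; _∩_; _∪_; _─_; ∁; ∣_∣; ⊤; ⊥; inside; outside)
open import Data.Fin.Subset.Properties
  using (_∈?_; ∈⊤; ⊆⊤; ∉⊥; ⊆-refl; ⊆-antisym; Empty-unique; ∣⊥∣≡0; p⊆q⇒∣p∣≤∣q∣;
         x∈p∩q⁺; x∈p∩q⁻; x∈p∪q⁺; x∈p∪q⁻; p─q⊆p; x∈p∧x∉q⇒x∈p─q;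
         x∈∁p⇒x∉p; x∉p⇒x∈∁p; ∪-comm; ∩-assoc; ∩-zeroˡ; ∩-distribˡ-∪;
         ∪-identityˡ)
open import Data.Vec.Base using ([]; _∷_; here; there)
open import Data.List using (List; []; _∷_; _++_; map)
open import Data.List.Relation.Unary.All as All using (All; []; _∷_)
open import Data.List.Relation.Unary.All.Properties using (++⁺; map⁺)
open import Data.Product using (Σ; _×_; _,_; proj₁; proj₂; ∃₂)
open import Data.Sum using (_⊎_; inj₁; inj₂; [_,_]; map₁) renaming (map to map⊎)
open import Data.Unit using (tt)
open import Data.Empty using (⊥-elim)
open import Function using (_∘_; id)
open import Relation.Nullary using (yes; no; contradiction)
open import Relation.Binary.PropositionalEquality
  using (_≡_; refl; sym; trans; cong; cong₂; subst; module ≡-Reasoning)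

private variable
  n : ℕ
  x : Fin n
  p q r : Subset n

x∈p─q⁻ : ∀ (p q : Subset n) → x ∈ p ─ q → x ∈ p × x ∉ q
x∈p─q⁻ p q x∈p─q = p─q⊆p p q x∈p─q , x∉q p q x∈p─q
  where
  x∉q : ∀ {n} {x : Fin n} (p q : Subset n) → x ∈ p ─ q → x ∉ q
  x∉q (_ ∷ p) (outside ∷ q) here ()
  x∉q (_ ∷ p) (_ ∷ q) (there x∈p─q) (there x∈q) = x∉q p q x∈p─q x∈q

x∉p∩q⁻ : x ∉ p ∩ q → x ∉ p ⊎ x ∉ q
x∉p∩q⁻ {x = x} {p = p} x∉p∩q with x ∈? p
... | yes x∈p = inj₂ λ x∈q → x∉p∩q (x∈p∩q⁺ (x∈p , x∈q))
... | no x∉p  = inj₁ x∉p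

p∪q≡⊤⁻ : ∀ (p q : Subset n) → p ∪ q ≡ ⊤ → ∀ x → x ∈ p ⊎ x ∈ q
p∪q≡⊤⁻ p q p∪q≡⊤ x = x∈p∪q⁻ p q (subst (x ∈_) (sym p∪q≡⊤) ∈⊤)

p∪q≡⊤⁺ : (∀ x → x ∈ p ⊎ x ∈ q) → p ∪ q ≡ ⊤
p∪q≡⊤⁺ covers = ⊆-antisym ⊆⊤ (λ {x} _ → x∈p∪q⁺ (covers x))

p∪q≡⊤∧x∉p⇒x∈q─p : p ∪ q ≡ ⊤ → x ∉ p → x ∈ q ─ p
p∪q≡⊤∧x∉p⇒x∈q─p {p = p} {q} {x} p∪q≡⊤ x∉p with p∪q≡⊤⁻ p q p∪q≡⊤ x
... | inj₁ x∈p = contradiction x∈p x∉p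
... | inj₂ x∈q = x∈p∧x∉q⇒x∈p─q x∈q x∉p

p∪q≡⊤∧x∉q⇒x∈p─q : p ∪ q ≡ ⊤ → x ∉ q → x ∈ p ─ q
p∪q≡⊤∧x∉q⇒x∈p─q {p = p} {q} p∪q≡⊤ = p∪q≡⊤∧x∉p⇒x∈q─p (trans (∪-comm q p) p∪q≡⊤)

p∩q─r∪s⁻ : ∀ (p q r s : Subset n) → x ∈ p ∩ q ─ (r ∪ s) → x ∈ p ─ r × x ∈ q ─ s
p∩q─r∪s⁻ p q r s x∈p∩q─r∪s with x∈p─q⁻ (p ∩ q) (r ∪ s) x∈p∩q─r∪s
... | x∈p∩q , x∉r∪s with x∈p∩q⁻ p q x∈p∩q
...   | x∈p , x∈q = x∈p∧x∉q⇒x∈p─q x∈p (x∉r∪s ∘ x∈p∪q⁺ ∘ inj₁)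
                  , x∈p∧x∉q⇒x∈p─q x∈q (x∉r∪s ∘ x∈p∪q⁺ ∘ inj₂)

p∩q≡⊥⁻ : p ∩ q ≡ ⊥ → x ∈ p → x ∉ q
p∩q≡⊥⁻ p∩q≡⊥ x∈p x∈q = ∉⊥ (subst (_ ∈_) p∩q≡⊥ (x∈p∩q⁺ (x∈p , x∈q)))

q⊆∁p⇒p∩q≡⊥ : q ⊆ ∁ p → p ∩ q ≡ ⊥
q⊆∁p⇒p∩q≡⊥ {q = q} {p = p} q⊆∁p = Empty-unique λ (_ , x∈p∩q) →
  let x∈p , x∈q = x∈p∩q⁻ p q x∈p∩q in x∈∁p⇒x∉p (q⊆∁p x∈q) x∈p

p∩q≡⊥⇒q⊆∁p : p ∩ q ≡ ⊥ → q ⊆ ∁ p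
p∩q≡⊥⇒q⊆∁p p∩q≡⊥ x∈q = x∉p⇒x∈∁p λ x∈p → p∩q≡⊥⁻ p∩q≡⊥ x∈p x∈q

p∩q≡⊥∧p∩r≡⊥⇒p∩[q∪r]≡⊥ : p ∩ q ≡ ⊥ → p ∩ r ≡ ⊥ → p ∩ (q ∪ r) ≡ ⊥
p∩q≡⊥∧p∩r≡⊥⇒p∩[q∪r]≡⊥ {p = p} {q} {r} p∩q≡⊥ p∩r≡⊥ = begin
  p ∩ (q ∪ r)        ≡⟨ ∩-distribˡ-∪ p q r ⟩
  (p ∩ q) ∪ (p ∩ r)  ≡⟨ cong₂ _∪_ p∩q≡⊥ p∩r≡⊥ ⟩
  ⊥ ∪ ⊥              ≡⟨ ∪-identityˡ ⊥ ⟩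
  ⊥                  ∎
  where open ≡-Reasoning

p∩q≡⊥⇒p∩[q∩r]≡⊥ : p ∩ q ≡ ⊥ → p ∩ (q ∩ r) ≡ ⊥
p∩q≡⊥⇒p∩[q∩r]≡⊥ {p = p} {q} {r} p∩q≡⊥ = begin
  p ∩ (q ∩ r)  ≡⟨ ∩-assoc p q r ⟨
  (p ∩ q) ∩ r  ≡⟨ cong (_∩ r) p∩q≡⊥ ⟩
  ⊥ ∩ r        ≡⟨ ∩-zeroˡ r ⟩
  ⊥            ∎
  where open ≡-Reasoning

q⊆p⇒p∪q≡p : q ⊆ p → p ∪ q ≡ p
q⊆p⇒p∪q≡p {q = q} {p = p} q⊆p =
  ⊆-antisym (λ x∈p∪q → [ id , q⊆p ] (x∈p∪q⁻ p q x∈p∪q)) (x∈p∪q⁺ ∘ inj₁)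

q⊆p⇒p∩q≡q : q ⊆ p → p ∩ q ≡ q
q⊆p⇒p∩q≡q {q = q} {p = p} q⊆p =
  ⊆-antisym (proj₂ ∘ x∈p∩q⁻ p q) (λ x∈q → x∈p∩q⁺ (q⊆p x∈q , x∈q))

p∪q≡⊤⇒∁[q─p]≡p : p ∪ q ≡ ⊤ → ∁ (q ─ p) ≡ p
p∪q≡⊤⇒∁[q─p]≡p {p = p} {q} p∪q≡⊤ = ⊆-antisym ∁[q─p]⊆p p⊆∁[q─p]
  where
  ∁[q─p]⊆p : ∁ (q ─ p) ⊆ p
  ∁[q─p]⊆p {x} x∈∁[q─p] with x ∈? p
  ... | yes x∈p = x∈p
  ... | no x∉p  = contradiction (p∪q≡⊤∧x∉p⇒x∈q─p p∪q≡⊤ x∉p) (x∈∁p⇒x∉p x∈∁[q─p])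
  p⊆∁[q─p] : p ⊆ ∁ (q ─ p)
  p⊆∁[q─p] x∈p = x∉p⇒x∈∁p λ x∈q─p → proj₂ (x∈p─q⁻ q p x∈q─p) x∈p

p⊆q⇒∣p─q∣≡0 : ∀ {n} {p q : Subset n} → p ⊆ q → ∣ p ─ q ∣ ≡ 0
p⊆q⇒∣p─q∣≡0 {n} {p} {q} p⊆q = n≤0⇒n≡0 (begin
  ∣ p ─ q ∣  ≤⟨ p⊆q⇒∣p∣≤∣q∣ p─q⊆⊥ ⟩
  ∣ ⊥ {n} ∣  ≡⟨ ∣⊥∣≡0 n ⟩
  0          ∎)
  where
  open ≤-Reasoning
  p─q⊆⊥ : p ─ q ⊆ ⊥
  p─q⊆⊥ x∈p─q = let x∈p , x∉q = x∈p─q⁻ p q x∈p─q in contradiction (p⊆q x∈p) x∉q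

∣p∪q∣+∣p∩q∣≡∣p∣+∣q∣ : ∀ (p q : Subset n) → ∣ p ∪ q ∣ + ∣ p ∩ q ∣ ≡ ∣ p ∣ + ∣ q ∣
∣p∪q∣+∣p∩q∣≡∣p∣+∣q∣ []            []            = refl
∣p∪q∣+∣p∩q∣≡∣p∣+∣q∣ (outside ∷ p) (outside ∷ q) = ∣p∪q∣+∣p∩q∣≡∣p∣+∣q∣ p q
∣p∪q∣+∣p∩q∣≡∣p∣+∣q∣ (inside ∷ p)  (outside ∷ q) = cong suc (∣p∪q∣+∣p∩q∣≡∣p∣+∣q∣ p q)
∣p∪q∣+∣p∩q∣≡∣p∣+∣q∣ (outside ∷ p) (inside ∷ q)  =
  trans (cong suc (∣p∪q∣+∣p∩q∣≡∣p∣+∣q∣ p q)) (sym (+-suc ∣ p ∣ ∣ q ∣))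
∣p∪q∣+∣p∩q∣≡∣p∣+∣q∣ (inside ∷ p)  (inside ∷ q)  = cong suc (begin
  ∣ p ∪ q ∣ + suc ∣ p ∩ q ∣  ≡⟨ +-suc ∣ p ∪ q ∣ ∣ p ∩ q ∣ ⟩
  suc (∣ p ∪ q ∣ + ∣ p ∩ q ∣) ≡⟨ cong suc (∣p∪q∣+∣p∩q∣≡∣p∣+∣q∣ p q) ⟩
  suc (∣ p ∣ + ∣ q ∣)         ≡⟨ +-suc ∣ p ∣ ∣ q ∣ ⟨
  ∣ p ∣ + suc ∣ q ∣           ∎)
  where open ≡-Reasoning

∩-monoˡ-⊆ : p ⊆ q → p ∩ r ⊆ q ∩ r
∩-monoˡ-⊆ {p = p} {r = r} p⊆q x∈p∩r =
  let x∈p , x∈r = x∈p∩q⁻ p r x∈p∩r in x∈p∩q⁺ (p⊆q x∈p , x∈r)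

∪-monoˡ-⊆ : p ⊆ q → p ∪ r ⊆ q ∪ r
∪-monoˡ-⊆ {p = p} {r = r} p⊆q x∈p∪r = x∈p∪q⁺ (map₁ p⊆q (x∈p∪q⁻ p r x∈p∪r))

p∩r─q∩r⊆p─q : p ∩ r ─ q ∩ r ⊆ p ─ q
p∩r─q∩r⊆p─q {p = p} {r = r} {q = q} x∈ =
  let x∈p∩r , x∉q∩r = x∈p─q⁻ (p ∩ r) (q ∩ r) x∈
      x∈p , x∈r = x∈p∩q⁻ p r x∈p∩r
  in x∈p∧x∉q⇒x∈p─q x∈p λ x∈q → x∉q∩r (x∈p∩q⁺ (x∈q , x∈r))

p∪r─q∪r⊆p─q : p ∪ r ─ q ∪ r ⊆ p ─ q
p∪r─q∪r⊆p─q {p = p} {r = r} {q = q} x∈ with x∈p─q⁻ (p ∪ r) (q ∪ r) x∈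
... | x∈p∪r , x∉q∪r with x∈p∪q⁻ p r x∈p∪r
...   | inj₁ x∈p = x∈p∧x∉q⇒x∈p─q x∈p (x∉q∪r ∘ x∈p∪q⁺ ∘ inj₁)
...   | inj₂ x∈r = contradiction (x∈p∪q⁺ (inj₂ x∈r)) x∉q∪r

infixl 7 _⊓ˢ_
infixl 6 _⊔ˢ_

_⊓ˢ_ _⊔ˢ_ : Sep n → Sep n → Sep n
(A , B) ⊓ˢ (X , Y) = A ∩ X , B ∪ Y
(A , B) ⊔ˢ (X , Y) = A ∪ X , B ∩ Y

module _ {G : Digraph n} where

  IsSeparation-⊓ˢ : ∀ {s t} → IsSeparation G s → IsSeparation G t → IsSeparation G (s ⊓ˢ t)
  IsSeparation-⊓ˢ {A , B} {X , Y} (AB-cover , AB-edges) (XY-cover , XY-edges) =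
    p∪q≡⊤⁺ cover , edges
    where
    cover : ∀ x → x ∈ A ∩ X ⊎ x ∈ B ∪ Y
    cover x with p∪q≡⊤⁻ A B AB-cover x | p∪q≡⊤⁻ X Y XY-cover x
    ... | inj₁ x∈A | inj₁ x∈X = inj₁ (x∈p∩q⁺ (x∈A , x∈X))
    ... | inj₂ x∈B | _        = inj₂ (x∈p∪q⁺ (inj₁ x∈B))
    ... | inj₁ _   | inj₂ x∈Y = inj₂ (x∈p∪q⁺ (inj₂ x∈Y))
    edges : ∀ u v → Edge G u v → u ∈ A ∩ X ─ B ∪ Y → v ∉ B ∪ Y ─ A ∩ X
    edges u v uv u∈ v∈
      with p∩q─r∪s⁻ A X B Y u∈ | x∉p∩q⁻ (proj₂ (x∈p─q⁻ (B ∪ Y) (A ∩ X) v∈))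
    ... | u∈A─B , _     | inj₁ v∉A = AB-edges u v uv u∈A─B (p∪q≡⊤∧x∉p⇒x∈q─p AB-cover v∉A)
    ... | _     , u∈X─Y | inj₂ v∉X = XY-edges u v uv u∈X─Y (p∪q≡⊤∧x∉p⇒x∈q─p XY-cover v∉X)

  IsSeparation-⊔ˢ : ∀ {s t} → IsSeparation G s → IsSeparation G t → IsSeparation G (s ⊔ˢ t)
  IsSeparation-⊔ˢ {A , B} {X , Y} (AB-cover , AB-edges) (XY-cover , XY-edges) =
    p∪q≡⊤⁺ cover , edges
    where
    cover : ∀ x → x ∈ A ∪ X ⊎ x ∈ B ∩ Y
    cover x with p∪q≡⊤⁻ A B AB-cover x | p∪q≡⊤⁻ X Y XY-cover x
    ... | inj₂ x∈B | inj₂ x∈Y = inj₂ (x∈p∩q⁺ (x∈B , x∈Y))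
    ... | inj₁ x∈A | _        = inj₁ (x∈p∪q⁺ (inj₁ x∈A))
    ... | inj₂ _   | inj₁ x∈X = inj₁ (x∈p∪q⁺ (inj₂ x∈X))
    edges : ∀ u v → Edge G u v → u ∈ A ∪ X ─ B ∩ Y → v ∉ B ∩ Y ─ A ∪ X
    edges u v uv u∈ v∈
      with x∉p∩q⁻ (proj₂ (x∈p─q⁻ (A ∪ X) (B ∩ Y) u∈)) | p∩q─r∪s⁻ B Y A X v∈
    ... | inj₁ u∉B | v∈B─A , _ = AB-edges u v uv (p∪q≡⊤∧x∉q⇒x∈p─q AB-cover u∉B) v∈B─A
    ... | inj₂ u∉Y | _ , v∈Y─X = XY-edges u v uv (p∪q≡⊤∧x∉q⇒x∈p─q XY-cover u∉Y) v∈Y─X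

order-submodular : ∀ (s t : Sep n) → order (s ⊓ˢ t) + order (s ⊔ˢ t) ≤ order s + order t
order-submodular (A , B) (X , Y) = begin
  ∣ lower ∣ + ∣ upper ∣                       ≡⟨ ∣p∪q∣+∣p∩q∣≡∣p∣+∣q∣ lower upper ⟨
  ∣ lower ∪ upper ∣ + ∣ lower ∩ upper ∣       ≤⟨ +-mono-≤ (p⊆q⇒∣p∣≤∣q∣ ∪⊆) (p⊆q⇒∣p∣≤∣q∣ ∩⊆) ⟩
  ∣ A ∩ B ∪ X ∩ Y ∣ + ∣ (A ∩ B) ∩ (X ∩ Y) ∣  ≡⟨ ∣p∪q∣+∣p∩q∣≡∣p∣+∣q∣ (A ∩ B) (X ∩ Y) ⟩
  ∣ A ∩ B ∣ + ∣ X ∩ Y ∣                       ∎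
  where
  open ≤-Reasoning
  lower upper : Subset _
  lower = (A ∩ X) ∩ (B ∪ Y)
  upper = (A ∪ X) ∩ (B ∩ Y)
  ∪⊆ : lower ∪ upper ⊆ A ∩ B ∪ X ∩ Y
  ∪⊆ x∈ with x∈p∪q⁻ lower upper x∈
  ... | inj₁ x∈lower with x∈p∩q⁻ (A ∩ X) (B ∪ Y) x∈lower
  ...   | x∈A∩X , x∈B∪Y with x∈p∩q⁻ A X x∈A∩X | x∈p∪q⁻ B Y x∈B∪Y
  ...     | x∈A , _ | inj₁ x∈B = x∈p∪q⁺ (inj₁ (x∈p∩q⁺ (x∈A , x∈B)))
  ...     | _ , x∈X | inj₂ x∈Y = x∈p∪q⁺ (inj₂ (x∈p∩q⁺ (x∈X , x∈Y)))
  ∪⊆ x∈ | inj₂ x∈upper with x∈p∩q⁻ (A ∪ X) (B ∩ Y) x∈upper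
  ...   | x∈A∪X , x∈B∩Y with x∈p∪q⁻ A X x∈A∪X | x∈p∩q⁻ B Y x∈B∩Y
  ...     | inj₁ x∈A | x∈B , _ = x∈p∪q⁺ (inj₁ (x∈p∩q⁺ (x∈A , x∈B)))
  ...     | inj₂ x∈X | _ , x∈Y = x∈p∪q⁺ (inj₂ (x∈p∩q⁺ (x∈X , x∈Y)))
  ∩⊆ : lower ∩ upper ⊆ (A ∩ B) ∩ (X ∩ Y)
  ∩⊆ x∈ =
    let x∈lower , x∈upper = x∈p∩q⁻ lower upper x∈
        x∈A∩X , _ = x∈p∩q⁻ (A ∩ X) (B ∪ Y) x∈lower
        _ , x∈B∩Y = x∈p∩q⁻ (A ∪ X) (B ∩ Y) x∈upper
        x∈A , x∈X = x∈p∩q⁻ A X x∈A∩X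
        x∈B , x∈Y = x∈p∩q⁻ B Y x∈B∩Y
    in x∈p∩q⁺ (x∈p∩q⁺ (x∈A , x∈B) , x∈p∩q⁺ (x∈X , x∈Y))

⊓ˢ-monoˡ-Nested : ∀ (t s s′ : Sep n) → Nested s s′ → Nested (s ⊓ˢ t) (s′ ⊓ˢ t)
⊓ˢ-monoˡ-Nested _ _ _ (A⊆A′ , B′⊆B) = ∩-monoˡ-⊆ A⊆A′ , ∪-monoˡ-⊆ B′⊆B

⊔ˢ-monoˡ-Nested : ∀ (t s s′ : Sep n) → Nested s s′ → Nested (s ⊔ˢ t) (s′ ⊔ˢ t)
⊔ˢ-monoˡ-Nested _ _ _ (A⊆A′ , B′⊆B) = ∪-monoˡ-⊆ A⊆A′ , ∩-monoˡ-⊆ B′⊆B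

⊓ˢ-monoˡ-NoGap : ∀ (t s s′ : Sep n) → NoGap s s′ → NoGap (s ⊓ˢ t) (s′ ⊓ˢ t)
⊓ˢ-monoˡ-NoGap (X , Y) (A , B) (A′ , B′) =
  map⊎ (≤-trans (p⊆q⇒∣p∣≤∣q∣ (p∩r─q∩r⊆p─q {p = A′} {r = X} {q = A})))
       (≤-trans (p⊆q⇒∣p∣≤∣q∣ (p∪r─q∪r⊆p─q {p = B} {r = Y} {q = B′})))

⊔ˢ-monoˡ-NoGap : ∀ (t s s′ : Sep n) → NoGap s s′ → NoGap (s ⊔ˢ t) (s′ ⊔ˢ t)
⊔ˢ-monoˡ-NoGap (X , Y) (A , B) (A′ , B′) =
  map⊎ (≤-trans (p⊆q⇒∣p∣≤∣q∣ (p∪r─q∪r⊆p─q {p = A′} {r = X} {q = A})))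
       (≤-trans (p⊆q⇒∣p∣≤∣q∣ (p∩r─q∩r⊆p─q {p = B} {r = Y} {q = B′})))

⊓ˢ-Nestedʳ : ∀ (s t : Sep n) → Nested (s ⊓ˢ t) t
⊓ˢ-Nestedʳ (A , _) (X , _) = proj₂ ∘ x∈p∩q⁻ A X , x∈p∪q⁺ ∘ inj₂

⊔ˢ-Nestedʳ : ∀ (s t : Sep n) → Nested t (s ⊔ˢ t)
⊔ˢ-Nestedʳ (_ , B) (_ , Y) = x∈p∪q⁺ ∘ inj₂ , proj₂ ∘ x∈p∩q⁻ B Y

NoGap-⊆ˡ : ∀ (s s′ : Sep n) → proj₁ s′ ⊆ proj₁ s → NoGap s s′
NoGap-⊆ˡ _ _ A′⊆A = inj₁ (≤-trans (≤-reflexive (p⊆q⇒∣p─q∣≡0 A′⊆A)) z≤n)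

NoGap-⊆ʳ : ∀ (s s′ : Sep n) → proj₂ s ⊆ proj₂ s′ → NoGap s s′
NoGap-⊆ʳ _ _ B⊆B′ = inj₂ (≤-trans (≤-reflexive (p⊆q⇒∣p─q∣≡0 B⊆B′)) z≤n)

module _ {G : Digraph n} {S T : Subset n} where

  IsSTSeparation-⊓ˢ : ∀ {s t} → IsSTSeparation G S T s → IsSTSeparation G S T t →
                      IsSTSeparation G S T (s ⊓ˢ t)
  IsSTSeparation-⊓ˢ (s-sep , S∩B≡⊥ , T∩A≡⊥) (t-sep , S∩Y≡⊥ , _) =
    IsSeparation-⊓ˢ s-sep t-sep ,
    p∩q≡⊥∧p∩r≡⊥⇒p∩[q∪r]≡⊥ S∩B≡⊥ S∩Y≡⊥ ,
    p∩q≡⊥⇒p∩[q∩r]≡⊥ T∩A≡⊥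

  IsSTSeparation-⊔ˢ : ∀ {s t} → IsSTSeparation G S T s → IsSTSeparation G S T t →
                      IsSTSeparation G S T (s ⊔ˢ t)
  IsSTSeparation-⊔ˢ (s-sep , S∩B≡⊥ , T∩A≡⊥) (t-sep , _ , T∩X≡⊥) =
    IsSeparation-⊔ˢ s-sep t-sep ,
    p∩q≡⊥⇒p∩[q∩r]≡⊥ S∩B≡⊥ ,
    p∩q≡⊥∧p∩r≡⊥⇒p∩[q∪r]≡⊥ T∩A≡⊥ T∩X≡⊥

  module _ {t : Sep n} (t-min : IsMinSTSeparation G S T t) where

    order-⊓ˢ-≤ : ∀ {s} → IsSTSeparation G S T s → order (s ⊓ˢ t) ≤ order s
    order-⊓ˢ-≤ {s} s-st = +-cancelʳ-≤ (order t) (order (s ⊓ˢ t)) (order s) (begin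
      order (s ⊓ˢ t) + order t         ≤⟨ +-monoʳ-≤ (order (s ⊓ˢ t)) t≤s⊔ˢt ⟩
      order (s ⊓ˢ t) + order (s ⊔ˢ t)  ≤⟨ order-submodular s t ⟩
      order s + order t                ∎)
      where
      open ≤-Reasoning
      t≤s⊔ˢt : order t ≤ order (s ⊔ˢ t)
      t≤s⊔ˢt = proj₂ t-min (s ⊔ˢ t) (IsSTSeparation-⊔ˢ s-st (proj₁ t-min))

    order-⊔ˢ-≤ : ∀ {s} → IsSTSeparation G S T s → order (s ⊔ˢ t) ≤ order s
    order-⊔ˢ-≤ {s} s-st = +-cancelˡ-≤ (order t) (order (s ⊔ˢ t)) (order s) (begin
      order t + order (s ⊔ˢ t)         ≤⟨ +-monoˡ-≤ (order (s ⊔ˢ t)) t≤s⊓ˢt ⟩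
      order (s ⊓ˢ t) + order (s ⊔ˢ t)  ≤⟨ order-submodular s t ⟩
      order s + order t                ≡⟨ +-comm (order s) (order t) ⟩
      order t + order s                ∎)
      where
      open ≤-Reasoning
      t≤s⊓ˢt : order t ≤ order (s ⊓ˢ t)
      t≤s⊓ˢt = proj₂ t-min (s ⊓ˢ t) (IsSTSeparation-⊓ˢ s-st (proj₁ t-min))

last : ∀ {E : Set} → E → List E → E
last e []       = e
last _ (e ∷ es) = last e es

last-map : ∀ {E F : Set} (f : E → F) e es → last (f e) (map f es) ≡ f (last e es)
last-map f e []       = refl
last-map f _ (e ∷ es) = last-map f e es

lastA-last : ∀ (s : Sep n) ss → lastA (s ∷ ss) ≡ proj₁ (last s ss)
lastA-last s []       = refl
lastA-last _ (s ∷ ss) = lastA-last s ss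

lastA-map : ∀ (f : Sep n → Sep n) s ss → lastA (map f (s ∷ ss)) ≡ proj₁ (f (last s ss))
lastA-map f s ss = trans (lastA-last (f s) (map f ss)) (cong proj₁ (last-map f s ss))

lastA-++ : ∀ (ss : List (Sep n)) t ts → lastA (ss ++ t ∷ ts) ≡ lastA (t ∷ ts)
lastA-++ []           t ts = refl
lastA-++ (_ ∷ [])     t ts = refl
lastA-++ (_ ∷ s ∷ ss) t ts = lastA-++ (s ∷ ss) t ts

module _ {R : Sep n → Sep n → Set} where

  Consecutive-map : ∀ {R′ : Sep n → Sep n → Set} (f : Sep n → Sep n) →
                    (∀ s s′ → R s s′ → R′ (f s) (f s′)) →
                    ∀ ss → Consecutive R ss → Consecutive R′ (map f ss)
  Consecutive-map f f-resp []           _        = tt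
  Consecutive-map f f-resp (_ ∷ [])     _        = tt
  Consecutive-map f f-resp (_ ∷ s ∷ ss) (r , rs) =
    f-resp _ _ r , Consecutive-map f f-resp (s ∷ ss) rs

  Consecutive-++ : ∀ s ss {t ts} → Consecutive R (s ∷ ss) → R (last s ss) t →
                   Consecutive R (t ∷ ts) → Consecutive R ((s ∷ ss) ++ t ∷ ts)
  Consecutive-++ _ []       _        r r′ = r , r′
  Consecutive-++ _ (s ∷ ss) (r , rs) r′ r″ = r , Consecutive-++ s ss rs r′ r″

Nested⇒⊆firstB : ∀ (ss : List (Sep n)) → Consecutive Nested ss → All (λ s → proj₂ s ⊆ firstB ss) ss
Nested⇒⊆firstB []           _                 = []
Nested⇒⊆firstB (_ ∷ [])     _                 = ⊆-refl ∷ []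
Nested⇒⊆firstB (_ ∷ s ∷ ss) ((_ , B′⊆B) , ns) =
  ⊆-refl ∷ All.map (λ ⊆B′ {_} x∈ → B′⊆B (⊆B′ x∈)) (Nested⇒⊆firstB (s ∷ ss) ns)

Nested⇒⊆lastA : ∀ (ss : List (Sep n)) → Consecutive Nested ss → All (λ s → proj₁ s ⊆ lastA ss) ss
Nested⇒⊆lastA []           _                 = []
Nested⇒⊆lastA (_ ∷ [])     _                 = ⊆-refl ∷ []
Nested⇒⊆lastA (_ ∷ s ∷ ss) ((A⊆A′ , _) , ns) with Nested⇒⊆lastA (s ∷ ss) ns
... | A′⊆ ∷ ⊆s = (λ x∈ → A′⊆ (A⊆A′ x∈)) ∷ A′⊆ ∷ ⊆s

module _ {G : Digraph n} where

  AllSeps⇒All : ∀ ss → AllSeps G ss → All (IsSeparation G) ss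
  AllSeps⇒All []       _            = []
  AllSeps⇒All (_ ∷ ss) (sep , seps) = sep ∷ AllSeps⇒All ss seps

  AllSeps-map : (f : Sep n → Sep n) → (∀ {s} → IsSeparation G s → IsSeparation G (f s)) →
                ∀ ss → AllSeps G ss → AllSeps G (map f ss)
  AllSeps-map f f-sep []       _            = tt
  AllSeps-map f f-sep (_ ∷ ss) (sep , seps) = f-sep sep , AllSeps-map f f-sep ss seps

  AllSeps-++ : ∀ ss {ts} → AllSeps G ss → AllSeps G ts → AllSeps G (ss ++ ts)
  AllSeps-++ []       _            seps′ = seps′
  AllSeps-++ (_ ∷ ss) (sep , seps) seps′ = sep , AllSeps-++ ss seps seps′

  IsSTChain⇒All-IsSTSeparation : ∀ {S T} ss → IsSTChain G S T ss → All (IsSTSeparation G S T) ss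
  IsSTChain⇒All-IsSTSeparation {S} {T} ss@(_ ∷ _) ((seps , nested) , B₀≡∁S , Aᵣ≡∁T) =
    All.zipWith st (AllSeps⇒All ss seps ,
                    All.zip (Nested⇒⊆firstB ss nested , Nested⇒⊆lastA ss nested))
    where
    st : ∀ {s} → IsSeparation G s × proj₂ s ⊆ firstB ss × proj₁ s ⊆ lastA ss →
         IsSTSeparation G S T s
    st (sep , B⊆B₀ , A⊆Aᵣ) =
      sep ,
      q⊆∁p⇒p∩q≡⊥ (subst (_ ⊆_) B₀≡∁S B⊆B₀) ,
      q⊆∁p⇒p∩q≡⊥ (subst (_ ⊆_) Aᵣ≡∁T A⊆Aᵣ)

chainOrder-lub : ∀ {k} (ss : List (Sep n)) → All (λ s → order s ≤ k) ss → chainOrder ss ≤ k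
chainOrder-lub []       []       = z≤n
chainOrder-lub (_ ∷ ss) (o ∷ os) = ⊔-lub o (chainOrder-lub ss os)

order≤chainOrder : ∀ (ss : List (Sep n)) → All (λ s → order s ≤ chainOrder ss) ss
order≤chainOrder []       = []
order≤chainOrder (s ∷ ss) =
  m≤m⊔n (order s) (chainOrder ss) ∷
  All.map (λ o → ≤-trans o (m≤n⊔m (order s) (chainOrder ss))) (order≤chainOrder ss)

module Uncrossing {G : Digraph n} {S T X Y : Subset n} (XY-min : IsMinSTSeparation G S T (X , Y))
  (c : Sep n) (cs : List (Sep n)) (C-chain : IsSTChain G S T (c ∷ cs)) (C-gapless : IsGapless (c ∷ cs))
  where

  t : Sep n
  t = X , Y

  lower upper : List (Sep n)
  lower = map (_⊓ˢ t) (c ∷ cs)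
  upper = map (_⊔ˢ t) (c ∷ cs)

  private
    C-seps : AllSeps G (c ∷ cs)
    C-seps = proj₁ (proj₁ C-chain)
    C-nested : Consecutive Nested (c ∷ cs)
    C-nested = proj₂ (proj₁ C-chain)
    B₀≡∁S : proj₂ c ≡ ∁ S
    B₀≡∁S = proj₁ (proj₂ C-chain)
    Aᵣ≡∁T : proj₁ (last c cs) ≡ ∁ T
    Aᵣ≡∁T = trans (sym (lastA-last c cs)) (proj₂ (proj₂ C-chain))
    XY-sep : IsSeparation G t
    XY-sep = proj₁ (proj₁ XY-min)
    XY-cover : X ∪ Y ≡ ⊤
    XY-cover = proj₁ XY-sep
    Y⊆∁S : Y ⊆ ∁ S
    Y⊆∁S = p∩q≡⊥⇒q⊆∁p (proj₁ (proj₂ (proj₁ XY-min)))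
    X⊆∁T : X ⊆ ∁ T
    X⊆∁T = p∩q≡⊥⇒q⊆∁p (proj₂ (proj₂ (proj₁ XY-min)))

    lower-seps : AllSeps G lower
    lower-seps = AllSeps-map (_⊓ˢ t) (λ sep → IsSeparation-⊓ˢ sep XY-sep) (c ∷ cs) C-seps
    upper-seps : AllSeps G upper
    upper-seps = AllSeps-map (_⊔ˢ t) (λ sep → IsSeparation-⊔ˢ sep XY-sep) (c ∷ cs) C-seps

    lower-nested : Consecutive Nested lower
    lower-nested = Consecutive-map (_⊓ˢ t) (⊓ˢ-monoˡ-Nested t) (c ∷ cs) C-nested
    upper-nested : Consecutive Nested upper
    upper-nested = Consecutive-map (_⊔ˢ t) (⊔ˢ-monoˡ-Nested t) (c ∷ cs) C-nested

    lower-gapless : IsGapless lower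
    lower-gapless = Consecutive-map (_⊓ˢ t) (⊓ˢ-monoˡ-NoGap t) (c ∷ cs) C-gapless
    upper-gapless : IsGapless upper
    upper-gapless = Consecutive-map (_⊔ˢ t) (⊔ˢ-monoˡ-NoGap t) (c ∷ cs) C-gapless

    lower-first : firstB lower ≡ ∁ S
    lower-first = trans (cong (_∪ Y) B₀≡∁S) (q⊆p⇒p∪q≡p Y⊆∁S)

    lower-last : lastA lower ≡ ∁ (Y ─ X)
    lower-last = begin
      lastA lower               ≡⟨ lastA-map (_⊓ˢ t) c cs ⟩
      proj₁ (last c cs) ∩ X     ≡⟨ cong (_∩ X) Aᵣ≡∁T ⟩
      ∁ T ∩ X                   ≡⟨ q⊆p⇒p∩q≡q X⊆∁T ⟩
      X                         ≡⟨ p∪q≡⊤⇒∁[q─p]≡p XY-cover ⟨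
      ∁ (Y ─ X)                 ∎
      where open ≡-Reasoning

    upper-first : firstB upper ≡ ∁ (X ─ Y)
    upper-first = begin
      proj₂ c ∩ Y               ≡⟨ cong (_∩ Y) B₀≡∁S ⟩
      ∁ S ∩ Y                   ≡⟨ q⊆p⇒p∩q≡q Y⊆∁S ⟩
      Y                         ≡⟨ p∪q≡⊤⇒∁[q─p]≡p (trans (∪-comm Y X) XY-cover) ⟨
      ∁ (X ─ Y)                 ∎
      where open ≡-Reasoning

    upper-last : lastA upper ≡ ∁ T
    upper-last = begin
      lastA upper               ≡⟨ lastA-map (_⊔ˢ t) c cs ⟩
      proj₁ (last c cs) ∪ X     ≡⟨ cong (_∪ X) Aᵣ≡∁T ⟩
      ∁ T ∪ X                   ≡⟨ q⊆p⇒p∪q≡p X⊆∁T ⟩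
      ∁ T                       ∎
      where open ≡-Reasoning

    last-lower : last (c ⊓ˢ t) (map (_⊓ˢ t) cs) ≡ last c cs ⊓ˢ t
    last-lower = last-map (_⊓ˢ t) c cs

    lower-t-nested : Nested (last (c ⊓ˢ t) (map (_⊓ˢ t) cs)) t
    lower-t-nested = subst (λ s → Nested s t) (sym last-lower) (⊓ˢ-Nestedʳ (last c cs) t)

    X⊆Aᵣ∩X : X ⊆ proj₁ (last c cs) ∩ X
    X⊆Aᵣ∩X x∈X = x∈p∩q⁺ (subst (_ ∈_) (sym Aᵣ≡∁T) (X⊆∁T x∈X) , x∈X)

    lower-t-noGap : NoGap (last (c ⊓ˢ t) (map (_⊓ˢ t) cs)) t
    lower-t-noGap = subst (λ s → NoGap s t) (sym last-lower) (NoGap-⊆ˡ (last c cs ⊓ˢ t) t X⊆Aᵣ∩X)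

    Y⊆B₀∩Y : Y ⊆ proj₂ c ∩ Y
    Y⊆B₀∩Y x∈Y = x∈p∩q⁺ (subst (_ ∈_) (sym B₀≡∁S) (Y⊆∁S x∈Y) , x∈Y)

  lower-chain : IsGaplessSTChain G S (Y ─ X) lower
  lower-chain = ((lower-seps , lower-nested) , lower-first , lower-last) , lower-gapless

  upper-chain : IsGaplessSTChain G (X ─ Y) T upper
  upper-chain = ((upper-seps , upper-nested) , upper-first , upper-last) , upper-gapless

  uncrossed-chain : IsGaplessSTChain G S T (lower ++ t ∷ upper)
  uncrossed-chain =
    ((AllSeps-++ lower lower-seps (XY-sep , upper-seps) ,
      Consecutive-++ (c ⊓ˢ t) (map (_⊓ˢ t) cs) lower-nested lower-t-nested
        (⊔ˢ-Nestedʳ c t , upper-nested)) ,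
     lower-first ,
     trans (lastA-++ lower t upper) upper-last) ,
    Consecutive-++ (c ⊓ˢ t) (map (_⊓ˢ t) cs) lower-gapless lower-t-noGap
      (NoGap-⊆ʳ t (c ⊔ˢ t) Y⊆B₀∩Y , upper-gapless)

  uncrossed-order : chainOrder (lower ++ t ∷ upper) ≤ chainOrder (c ∷ cs)
  uncrossed-order with All.zip (IsSTChain⇒All-IsSTSeparation (c ∷ cs) C-chain , order≤chainOrder (c ∷ cs))
  ... | members@((c-st , c≤) ∷ _) = chainOrder-lub (lower ++ t ∷ upper)
    (++⁺ (map⁺ (All.map (λ (s-st , s≤) → ≤-trans (order-⊓ˢ-≤ XY-min s-st) s≤) members))
         (≤-trans (proj₂ XY-min c c-st) c≤ ∷
          map⁺ (All.map (λ (s-st , s≤) → ≤-trans (order-⊔ˢ-≤ XY-min s-st) s≤) members)))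

lemma4 : ∀ {n} (G : Digraph n) (S T : Subset n) (k : ℕ) →
    Disjoint S T →
    (Σ (List (Sep n)) λ C → IsGaplessSTChain G S T C × chainOrder C ≡ k) →
    (X Y : Subset n) → IsMinSTSeparation G S T (X , Y) →
    ∃₂ λ (C₁ C₂ : List (Sep n)) →
      IsGaplessSTChain G S T (C₁ ++ ((X , Y) ∷ C₂)) ×
      chainOrder (C₁ ++ ((X , Y) ∷ C₂)) ≤ k ×
      IsGaplessSTChain G S (Y ─ X) C₁ ×
      IsGaplessSTChain G (X ─ Y) T C₂
lemma4 G S T k _ ([] , ((no-chain , _) , _) , _) X Y _ = ⊥-elim no-chain
lemma4 G S T k _ (c ∷ cs , (C-chain , C-gapless) , refl) X Y XY-min =
  lower , upper , uncrossed-chain , uncrossed-order , lower-chain , upper-chain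
  where open Uncrossing XY-min c cs C-chain C-gapless
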